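{- Let $G=(V,E)$ be a simple directed graph, let $v_1,\ldots,v_n$ be an ordering of $V$, and let $C_i=\{v_1,\ldots,v_i\}$ for $i=1,\ldots,n-1$. Let $k$ be a positive integer. If $d^{\sf out}_G(C_i)\le k$ and $d^{\sf in}_G(C_i)=0$ for all $i=1,\ldots,n-1$, then $|E|\le\sqrt{2k}\,n$.
   Context: For $R\subseteq V$, $d^{\sf out}_G(R)$ and $d^{\sf in}_G(R)$ denote the number of edges of $G$ leaving $R$ (tail in $R$, head not in $R$) and entering $R$ (head in $R$, tail not in $R$), respectively. Simple means no loops and no parallel edges. -}

module Defs where

open import Data.Nat using (ℕ; zero; suc; _<ᵇ_)
open import Data.Bool using (Bool; true; false; if_then_else_; _∧_; not)
open import Data.Fin using (Fin; toℕ)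
open import Data.List using (List; map; allFin)
open import Data.Nat.ListAction using (sum)
open import Relation.Binary.PropositionalEquality using (_≡_)
open import Function.Bundles using (_↔_; Inverse)

-- A directed graph on vertex set Fin n, given by its (decidable) adjacency
-- relation: G a b ≡ true iff (a , b) is an edge (tail a, head b).
-- Being a relation, there are no parallel edges.
Digraph : ℕ → Set
Digraph n = Fin n → Fin n → Bool

Loopless : ∀ {n} → Digraph n → Set
Loopless {n} G = (a : Fin n) → G a a ≡ false

countPairs : ∀ {n} → (Fin n → Fin n → Bool) → ℕ
countPairs {n} P =
  sum (map (λ a → sum (map (λ b → if P a b then 1 else 0) (allFin n))) (allFin n))

numEdges : ∀ {n} → Digraph n → ℕ
numEdges G = countPairs G

-- An ordering v_1,...,v_n of V is a bijection (inverse pair) v : Fin n ↔ Fin n, where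
-- v_(j+1) = v j (0-based index j).  position v a = index of a in the ordering.
position : ∀ {n} → (Fin n ↔ Fin n) → Fin n → ℕ
position v a = toℕ (Inverse.from v a)

inC : ∀ {n} → (Fin n ↔ Fin n) → ℕ → Fin n → Bool
inC v i a = position v a <ᵇ i

dOut : ∀ {n} → Digraph n → (Fin n ↔ Fin n) → ℕ → ℕ
dOut G v i = countPairs (λ a b → G a b ∧ inC v i a ∧ not (inC v i b))

dIn : ∀ {n} → Digraph n → (Fin n ↔ Fin n) → ℕ → ℕ
dIn G v i = countPairs (λ a b → G a b ∧ inC v i b ∧ not (inC v i a))

{-# OPTIONS --safe #-}
module Submission where

-- Every edge goes forward in the ordering, since an edge going backward would enter a
-- prefix C_i.  Let d(a) be the out-degree of a and L(a) the total length of its out-edges,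
-- measured by positions.  The out-neighbours of a occupy distinct positions after a, so
-- d(a)² ≤ 2 L(a); and an edge from position x to position y crosses exactly the y − x
-- cuts C_(x+1), …, C_y, so Σ_a L(a) = Σ_i d_out(C_i) ≤ n k.  Cauchy–Schwarz then gives
-- |E|² ≤ n Σ_a d(a)² ≤ 2 n Σ_a L(a) ≤ 2 k n².

open import Defs
open import Data.Nat using (ℕ; zero; suc; _+_; _*_; _∸_; _≤_; _<_; _<ᵇ_; z≤n; s≤s)
open import Data.Nat.Properties
open import Data.Nat.ListAction using () renaming (sum to sumList)
open import Data.Nat.Solver using (module +-*-Solver)
open import Data.Bool using (Bool; true; false; if_then_else_; _∧_; not; T)
open import Data.Bool.Properties using (∧-zeroʳ)
open import Data.Fin using (Fin; zero; suc; toℕ)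
open import Data.Fin.Properties using (toℕ<n; toℕ-injective)
import Data.Fin.Permutation as Permutation
open import Data.List using (map; allFin; tabulate)
open import Data.Vec.Functional using (Vector)
open import Data.Product using (_×_; proj₁; proj₂)
open import Data.Sum using ([_,_]′)
open import Data.Empty using (⊥-elim)
open import Function using (_∘_; id; case_of_)
open import Function.Bundles using (_↔_; Inverse)
open import Relation.Binary using (tri<; tri≈; tri>)
open import Relation.Binary.PropositionalEquality
  using (_≡_; refl; sym; trans; cong; cong₂; subst; subst₂; module ≡-Reasoning)
open import Algebra.Properties.Semiring.Sum +-*-semiring
  using (sum; sum-syntax; sum-cong-≗; ∑-comm; ∑-distrib-+; sum-permute; *-distribˡ-sum; *-distribʳ-sum)

𝟙 : Bool → ℕ
𝟙 b = if b then 1 else 0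

count : ∀ {n} → (Fin n → Bool) → ℕ
count {n} S = ∑[ i < n ] 𝟙 (S i)

sum-map-tabulate : ∀ {n} {A : Set} (f : A → ℕ) (g : Fin n → A) →
                   sumList (map f (tabulate g)) ≡ ∑[ i < n ] f (g i)
sum-map-tabulate {zero}  f g = refl
sum-map-tabulate {suc n} f g = cong (f (g zero) +_) (sum-map-tabulate f (g ∘ suc))

sum-map-allFin : ∀ n (f : Fin n → ℕ) → sumList (map f (allFin n)) ≡ ∑[ i < n ] f i
sum-map-allFin n f = sum-map-tabulate f id

countPairs≡∑count : ∀ {n} (P : Fin n → Fin n → Bool) → countPairs P ≡ ∑[ a < n ] count (P a)
countPairs≡∑count {n} P = begin
  sumList (map (λ a → sumList (map (𝟙 ∘ P a) (allFin n))) (allFin n))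
    ≡⟨ sum-map-allFin n _ ⟩
  ∑[ a < n ] sumList (map (𝟙 ∘ P a) (allFin n))
    ≡⟨ sum-cong-≗ (λ a → sum-map-allFin n (𝟙 ∘ P a)) ⟩
  ∑[ a < n ] count (P a) ∎
  where open ≡-Reasoning

sum-mono-≤ : ∀ {n} {f g : Vector ℕ n} → (∀ i → f i ≤ g i) → sum f ≤ sum g
sum-mono-≤ {zero}  f≤g = z≤n
sum-mono-≤ {suc n} f≤g = +-mono-≤ (f≤g zero) (sum-mono-≤ (f≤g ∘ suc))

≤-sum : ∀ {n} (f : Vector ℕ n) i → f i ≤ sum f
≤-sum f zero    = m≤m+n (f zero) _
≤-sum f (suc i) = ≤-trans (≤-sum (f ∘ suc) i) (m≤n+m _ (f zero))

sum-zero : ∀ {n} {f : Vector ℕ n} → (∀ i → f i ≡ 0) → sum f ≡ 0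
sum-zero {zero}  f≡0 = refl
sum-zero {suc n} f≡0 = cong₂ _+_ (f≡0 zero) (sum-zero (f≡0 ∘ suc))

sum-const : ∀ n c → ∑[ i < n ] c ≡ n * c
sum-const zero    c = refl
sum-const (suc n) c = cong (c +_) (sum-const n c)

sum-*-sum : ∀ {m n} (f : Vector ℕ m) (g : Vector ℕ n) →
            sum f * sum g ≡ ∑[ i < m ] ∑[ j < n ] (f i * g j)
sum-*-sum f g = trans (*-distribʳ-sum (sum g) f) (sum-cong-≗ (λ i → *-distribˡ-sum (f i) g))

2mn≤m²+n² : ∀ m n → 2 * (m * n) ≤ m * m + n * n
2mn≤m²+n² m n = [ ordered , flipped ]′ (≤-total m n)
  where
  ordered : ∀ {m n} → m ≤ n → 2 * (m * n) ≤ m * m + n * n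
  ordered {m} {n} m≤n = subst (λ n → 2 * (m * n) ≤ m * m + n * n) (m+[n∸m]≡n m≤n) (shifted m (n ∸ m))
    where
    open +-*-Solver
    shifted : ∀ m d → 2 * (m * (m + d)) ≤ m * m + (m + d) * (m + d)
    shifted m d = subst (2 * (m * (m + d)) ≤_)
      (solve 2 (λ m d → con 2 :* (m :* (m :+ d)) :+ d :* d := m :* m :+ (m :+ d) :* (m :+ d)) refl m d)
      (m≤m+n _ (d * d))
  flipped : n ≤ m → 2 * (m * n) ≤ m * m + n * n
  flipped n≤m = subst₂ _≤_ (cong (2 *_) (*-comm n m)) (+-comm (n * n) (m * m)) (ordered n≤m)

sum²≤n*sum-squares : ∀ {n} (f : Vector ℕ n) → sum f * sum f ≤ n * ∑[ i < n ] (f i * f i)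
sum²≤n*sum-squares {n} f = *-cancelˡ-≤ 2 (begin
  2 * (sum f * sum f)                           ≡⟨ cong (2 *_) (sum-*-sum f f) ⟩
  2 * ∑[ i < n ] ∑[ j < n ] (f i * f j)         ≡⟨ *-distribˡ-sum 2 (λ i → ∑[ j < n ] (f i * f j)) ⟩
  ∑[ i < n ] (2 * ∑[ j < n ] (f i * f j))       ≡⟨ sum-cong-≗ (λ i → *-distribˡ-sum 2 (λ j → f i * f j)) ⟩
  ∑[ i < n ] ∑[ j < n ] (2 * (f i * f j))       ≤⟨ sum-mono-≤ (λ i → sum-mono-≤ (λ j → 2mn≤m²+n² (f i) (f j))) ⟩
  ∑[ i < n ] ∑[ j < n ] (sq i + sq j)           ≡⟨ sum-cong-≗ (λ i → ∑-distrib-+ (λ _ → sq i) sq) ⟩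
  ∑[ i < n ] (∑[ j < n ] sq i + S)              ≡⟨ ∑-distrib-+ (λ i → ∑[ j < n ] sq i) (λ _ → S) ⟩
  ∑[ i < n ] ∑[ j < n ] sq i + ∑[ i < n ] S     ≡⟨ cong₂ _+_ (sum-cong-≗ (λ i → sum-const n (sq i))) (sum-const n S) ⟩
  ∑[ i < n ] (n * sq i) + n * S                 ≡⟨ cong (_+ n * S) (*-distribˡ-sum n sq) ⟨
  n * S + n * S                                 ≡⟨ cong (n * S +_) (+-identityʳ (n * S)) ⟨
  2 * (n * S)                                   ∎)
  where
  open ≤-Reasoning
  sq : Vector ℕ n
  sq i = f i * f i
  S = sum sq

<⇒<ᵇ≡true : ∀ {m n} → m < n → (m <ᵇ n) ≡ true
<⇒<ᵇ≡true {zero}  {suc n} _         = refl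
<⇒<ᵇ≡true {suc m} {suc n} (s≤s m<n) = <⇒<ᵇ≡true m<n

≥⇒<ᵇ≡false : ∀ {m n} → n ≤ m → (m <ᵇ n) ≡ false
≥⇒<ᵇ≡false z≤n       = refl
≥⇒<ᵇ≡false (s≤s n≤m) = ≥⇒<ᵇ≡false n≤m

-- x < j ≤ y; an edge from position x to position y leaves C_j exactly when between x y j.
between : ℕ → ℕ → ℕ → Bool
between x y j = (x <ᵇ j) ∧ not (y <ᵇ j)

count-between : ∀ {m} x y → y < m → ∑[ j < m ] 𝟙 (between x y (toℕ j)) ≡ y ∸ x
count-between {suc m} x y (s≤s y≤m) = shifted m x y y≤m
  where
  shifted : ∀ m x y → y ≤ m → ∑[ j < m ] 𝟙 (between x y (suc (toℕ j))) ≡ y ∸ x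
  shifted m       x       zero    _         = trans (sum-zero {m} (λ j → cong 𝟙 (∧-zeroʳ (x <ᵇ suc (toℕ j)))))
                                                    (sym (0∸n≡0 x))
  shifted (suc m) zero    (suc y) (s≤s y≤m) = cong suc (shifted m zero y y≤m)
  shifted (suc m) (suc x) (suc y) (s≤s y≤m) = shifted m x y y≤m

length≡crossings : ∀ g x {y m} → y < m → 𝟙 g * (y ∸ x) ≡ ∑[ j < m ] 𝟙 (g ∧ between x y (toℕ j))
length≡crossings true  x y<m = trans (*-identityˡ _) (sym (count-between x _ y<m))
length≡crossings false x {m = m} y<m = sym (sum-zero {m} (λ _ → refl))

either-weakly-before : ∀ s t y z → 𝟙 s * 𝟙 t ≤ 𝟙 s * 𝟙 (t ∧ not (y <ᵇ z)) + 𝟙 t * 𝟙 (s ∧ not (z <ᵇ y))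
either-weakly-before false t     y z = z≤n
either-weakly-before true  false y z = z≤n
either-weakly-before true  true  y z with y <ᵇ z in y<z | z <ᵇ y in z<y
... | false | _     = s≤s z≤n
... | true  | false = s≤s z≤n
... | true  | true  = ⊥-elim (<-asym (<ᵇ⇒< y z (subst T (sym y<z) _)) (<ᵇ⇒< z y (subst T (sym z<y) _)))

module _ {n} (v : Fin n ↔ Fin n) where

  position-injective : ∀ {a b} → position v a ≡ position v b → a ≡ b
  position-injective {a} {b} eq = begin
    a                                   ≡⟨ Permutation.inverseʳ v ⟨
    Inverse.to v (Inverse.from v a)     ≡⟨ cong (Inverse.to v) (toℕ-injective eq) ⟩
    Inverse.to v (Inverse.from v b)     ≡⟨ Permutation.inverseʳ v ⟩
    b                                   ∎
    where open ≡-Reasoning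

  ∑-position : (h : ℕ → ℕ) → ∑[ c < n ] h (position v c) ≡ ∑[ j < n ] h (toℕ j)
  ∑-position h = sym (sum-permute (h ∘ toℕ) (Permutation.flip v))

  count-weakly-before : (S : Fin n → Bool) (x : ℕ) → (∀ c → S c ≡ true → x < position v c) →
                        ∀ {y} → y < n → count (λ c → S c ∧ not (y <ᵇ position v c)) ≤ y ∸ x
  count-weakly-before S x after {y} y<n = begin
    count (λ c → S c ∧ not (y <ᵇ position v c))   ≤⟨ sum-mono-≤ in-interval ⟩
    ∑[ c < n ] 𝟙 (between x y (position v c))      ≡⟨ ∑-position (𝟙 ∘ between x y) ⟩
    ∑[ j < n ] 𝟙 (between x y (toℕ j))             ≡⟨ count-between x y y<n ⟩
    y ∸ x                                          ∎
    where
    open ≤-Reasoning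
    in-interval : ∀ c → 𝟙 (S c ∧ not (y <ᵇ position v c)) ≤ 𝟙 (between x y (position v c))
    in-interval c with S c in c∈S
    ... | false = z≤n
    ... | true rewrite <⇒<ᵇ≡true (after c c∈S) = ≤-refl

  count²≤2*∑distance : (S : Fin n → Bool) (x : ℕ) → (∀ c → S c ≡ true → x < position v c) →
                       count S * count S ≤ 2 * ∑[ c < n ] (𝟙 (S c) * (position v c ∸ x))
  count²≤2*∑distance S x after = begin
    count S * count S                                   ≡⟨ sum-*-sum (𝟙 ∘ S) (𝟙 ∘ S) ⟩
    ∑[ b < n ] ∑[ c < n ] (𝟙 (S b) * 𝟙 (S c))           ≤⟨ sum-mono-≤ (λ b → sum-mono-≤ (λ c →
                                                             either-weakly-before (S b) (S c) (p b) (p c))) ⟩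
    ∑[ b < n ] ∑[ c < n ] (w b c + w c b)               ≡⟨ sum-cong-≗ (λ b → ∑-distrib-+ (w b) (λ c → w c b)) ⟩
    ∑[ b < n ] (∑[ c < n ] w b c + ∑[ c < n ] w c b)    ≡⟨ ∑-distrib-+ (λ b → sum (w b)) (λ b → ∑[ c < n ] w c b) ⟩
    W + ∑[ b < n ] ∑[ c < n ] w c b                     ≡⟨ cong (W +_) (∑-comm (λ b c → w c b)) ⟩
    W + W                                               ≡⟨ cong (W +_) (+-identityʳ W) ⟨
    2 * W                                               ≤⟨ *-monoʳ-≤ 2 (sum-mono-≤ bounded) ⟩
    2 * ∑[ b < n ] (𝟙 (S b) * (p b ∸ x))                ∎
    where
    open ≤-Reasoning
    p = position v
    w : Fin n → Fin n → ℕ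
    w b c = 𝟙 (S b) * 𝟙 (S c ∧ not (p b <ᵇ p c))
    W = ∑[ b < n ] sum (w b)
    bounded : ∀ b → sum (w b) ≤ 𝟙 (S b) * (p b ∸ x)
    bounded b = begin
      sum (w b)                                         ≡⟨ *-distribˡ-sum (𝟙 (S b)) (λ c → 𝟙 (S c ∧ not (p b <ᵇ p c))) ⟨
      𝟙 (S b) * count (λ c → S c ∧ not (p b <ᵇ p c))    ≤⟨ *-monoʳ-≤ (𝟙 (S b))
                                                             (count-weakly-before S x after (toℕ<n (Inverse.from v b))) ⟩
      𝟙 (S b) * (p b ∸ x)                               ∎

countPairs≡0 : ∀ {n} (P : Fin n → Fin n → Bool) → countPairs P ≡ 0 → ∀ a b → P a b ≡ false
countPairs≡0 {n} P none a b = 𝟙≡0 (n≤0⇒n≡0 (begin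
  𝟙 (P a b)                  ≤⟨ ≤-sum (𝟙 ∘ P a) b ⟩
  count (P a)                ≤⟨ ≤-sum (count ∘ P) a ⟩
  ∑[ a < n ] count (P a)     ≡⟨ countPairs≡∑count P ⟨
  countPairs P               ≡⟨ none ⟩
  0                          ∎))
  where
  open ≤-Reasoning
  𝟙≡0 : ∀ {b} → 𝟙 b ≡ 0 → b ≡ false
  𝟙≡0 {false} _ = refl

module _ {n} (G : Digraph n) (v : Fin n ↔ Fin n) where

  outLength : Fin n → ℕ
  outLength a = ∑[ b < n ] (𝟙 (G a b) * (position v b ∸ position v a))

  dOut-∅ : dOut G v 0 ≡ 0
  dOut-∅ = trans (countPairs≡∑count {n} _) (sum-zero {n} (λ a → sum-zero {n} (λ b → cong 𝟙 (∧-zeroʳ (G a b)))))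

  ∑outLength≡∑dOut : ∑[ a < n ] outLength a ≡ ∑[ i < n ] dOut G v (toℕ i)
  ∑outLength≡∑dOut = begin
    ∑[ a < n ] outLength a                               ≡⟨ sum-cong-≗ (λ a → sum-cong-≗ (λ b →
                                                              length≡crossings (G a b) (p a) (toℕ<n (Inverse.from v b)))) ⟩
    ∑[ a < n ] ∑[ b < n ] ∑[ i < n ] crossing a b i       ≡⟨ sum-cong-≗ (λ a → ∑-comm (crossing a)) ⟩
    ∑[ a < n ] ∑[ i < n ] ∑[ b < n ] crossing a b i       ≡⟨ ∑-comm (λ a i → ∑[ b < n ] crossing a b i) ⟩
    ∑[ i < n ] ∑[ a < n ] ∑[ b < n ] crossing a b i       ≡⟨ sum-cong-≗ {n} (λ i → countPairs≡∑count {n} _) ⟨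
    ∑[ i < n ] dOut G v (toℕ i)                          ∎
    where
    open ≡-Reasoning
    p = position v
    crossing : Fin n → Fin n → Fin n → ℕ
    crossing a b i = 𝟙 (G a b ∧ between (p a) (p b) (toℕ i))

  ∑dOut≤n*k : ∀ k → (∀ i → 1 ≤ i → i ≤ n ∸ 1 → dOut G v i ≤ k) → ∑[ i < n ] dOut G v (toℕ i) ≤ n * k
  ∑dOut≤n*k k cut≤k = ≤-trans (sum-mono-≤ bounded) (≤-reflexive (sum-const n k))
    where
    bounded : (i : Fin n) → dOut G v (toℕ i) ≤ k
    bounded zero    = ≤-trans (≤-reflexive dOut-∅) z≤n
    bounded (suc i) = cut≤k (suc (toℕ i)) (s≤s z≤n) (<⇒≤pred (toℕ<n (suc i)))

  edges-forward : Loopless G → (∀ i → 1 ≤ i → i ≤ n ∸ 1 → dIn G v i ≡ 0) →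
                  ∀ a b → G a b ≡ true → position v a < position v b
  edges-forward loopless noEntry a b ab with <-cmp (position v a) (position v b)
  ... | tri< pa<pb _ _ = pa<pb
  ... | tri≈ _ pa≡pb _ with refl ← position-injective v pa≡pb = case trans (sym ab) (loopless a) of λ ()
  ... | tri> _ _ pb<pa = case trans (sym entering) (countPairs≡0 _ (noEntry i (s≤s z≤n) i≤n-1) a b) of λ ()
    where
    i = suc (position v b)
    i≤n-1 : i ≤ n ∸ 1
    i≤n-1 = <⇒≤pred (≤-trans (s≤s pb<pa) (toℕ<n (Inverse.from v a)))
    entering : (G a b ∧ inC v i b ∧ not (inC v i a)) ≡ true
    entering rewrite ab | <⇒<ᵇ≡true (n<1+n (position v b)) | ≥⇒<ᵇ≡false pb<pa = refl

lemma3 : (n k : ℕ) → 1 ≤ k → (G : Digraph n) → Loopless G → (v : Fin n ↔ Fin n) →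
         ((i : ℕ) → 1 ≤ i → i ≤ n ∸ 1 → (dOut G v i ≤ k) × (dIn G v i ≡ 0)) →
         numEdges G * numEdges G ≤ 2 * k * (n * n)
lemma3 n k _ G loopless v cuts = begin
  numEdges G * numEdges G                  ≡⟨ cong₂ _*_ (countPairs≡∑count G) (countPairs≡∑count G) ⟩
  sum outdeg * sum outdeg                  ≤⟨ sum²≤n*sum-squares outdeg ⟩
  n * ∑[ a < n ] (outdeg a * outdeg a)     ≤⟨ *-monoʳ-≤ n (sum-mono-≤ (λ a →
                                                count²≤2*∑distance v (G a) (position v a) (forward a))) ⟩
  n * ∑[ a < n ] (2 * outLength G v a)     ≡⟨ cong (n *_) (*-distribˡ-sum 2 (outLength G v)) ⟨
  n * (2 * ∑[ a < n ] outLength G v a)     ≡⟨ cong (λ t → n * (2 * t)) (∑outLength≡∑dOut G v) ⟩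
  n * (2 * ∑[ i < n ] dOut G v (toℕ i))    ≤⟨ *-monoʳ-≤ n (*-monoʳ-≤ 2 (∑dOut≤n*k G v k (λ i 1≤i i<n → proj₁ (cuts i 1≤i i<n)))) ⟩
  n * (2 * (n * k))                        ≡⟨ solve 2 (λ n k → n :* (con 2 :* (n :* k)) := con 2 :* k :* (n :* n)) refl n k ⟩
  2 * k * (n * n)                          ∎
  where
  open ≤-Reasoning
  open +-*-Solver
  outdeg : Fin n → ℕ
  outdeg a = count (G a)
  forward = edges-forward G v loopless (λ i 1≤i i<n → proj₂ (cuts i 1≤i i<n))
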